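{- For every $n\ge 1$ there is a bijection $\psi:\mathcal{M}^2_{n-1}\to R_n(1212)$ such that $\mathrm{area}(P)=\mathrm{rs}(\psi(P))$ for all $P\in\mathcal{M}^2_{n-1}$.
   Context: A restricted growth function (RGF) of length $n$ is a sequence $w=w_1\dots w_n$ of positive integers with $w_1=1$ and $w_i\le 1+\max\{w_1,\dots,w_{i-1}\}$ for $i\ge 2$; $R_n$ is the set of RGFs of length $n$. The standardization of a word replaces every occurrence of its smallest letter by $1$, of its next smallest letter by $2$, and so on. An RGF $w$ contains an RGF $v$ if some subword (subsequence, not necessarily consecutive) of $w$ standardizes to $v$; otherwise $w$ avoids $v$; $R_n(v)$ is the set of $w\in R_n$ avoiding $v$. For a word $w$ and position $j$, $\mathrm{rs}(w_j)$ is the number of distinct values $w_i$ with $i>j$ and $w_i<w_j$, and $\mathrm{rs}(w)=\sum_j\mathrm{rs}(w_j)$. A Motzkin path of length $m$ is a lattice path from $(0,0)$ to $(m,0)$ staying weakly above the $x$-axis with steps up $(1,1)$, horizontal $(1,0)$ and down $(1,-1)$. A two-colored Motzkin path is a Motzkin path each of whose horizontal steps is colored $a$ or $b$; $\mathcal{M}^2_m$ is the set of two-colored Motzkin paths of length $m$ ($\mathcal{M}^2_0$ contains only the empty path). $\mathrm{area}(P)$ is the area of the region between $P$ and the $x$-axis. -}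

module Defs where

open import Data.Nat using (ℕ; zero; suc; _+_; _*_; _∸_; _≤_; _<_; _<?_; _≟_)
open import Data.Nat.DivMod using (_/_)
open import Data.List using (List; []; _∷_; length; map; filter; deduplicate)
open import Data.List.Relation.Binary.Sublist.Propositional using (_⊆_)
open import Data.Product using (Σ; ∃; _×_)
open import Data.Unit using (⊤)
open import Relation.Nullary using (¬_)
open import Relation.Binary.PropositionalEquality using (_≡_)

data RGFFrom : ℕ → List ℕ → Set where
  []  : ∀ {m} → RGFFrom m []
  _∷_ : ∀ {m x ws} → (1 ≤ x × x ≤ suc m) → RGFFrom (m Data.Nat.⊔ x) ws →
        RGFFrom m (x ∷ ws)

IsRGF : List ℕ → Set
IsRGF []       = ⊤
IsRGF (x ∷ ws) = x ≡ 1 × RGFFrom 1 ws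

distinctBelow : ℕ → List ℕ → ℕ
distinctBelow x xs = length (filter (_<? x) (deduplicate _≟_ xs))

std : List ℕ → List ℕ
std u = map (λ x → suc (distinctBelow x u)) u

Contains : List ℕ → List ℕ → Set
Contains w v = ∃ λ u → u ⊆ w × std u ≡ v

Avoids : List ℕ → List ℕ → Set
Avoids w v = ¬ Contains w v

InR : ℕ → List ℕ → List ℕ → Set
InR n v w = IsRGF w × length w ≡ n × Avoids w v

rs : List ℕ → ℕ
rs []       = 0
rs (x ∷ xs) = distinctBelow x xs + rs xs

data Color : Set where
  a b : Color

data Step : Set where
  up   : Step
  flat : Color → Step
  down : Step

data MotzkinFrom : ℕ → List Step → Set where
  []   : MotzkinFrom 0 []
  up   : ∀ {h P} → MotzkinFrom (suc h) P → MotzkinFrom h (up ∷ P)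
  flat : ∀ {h P} c → MotzkinFrom h P → MotzkinFrom h (flat c ∷ P)
  down : ∀ {h P} → MotzkinFrom h P → MotzkinFrom (suc h) (down ∷ P)

IsMotzkin2 : ℕ → List Step → Set
IsMotzkin2 m P = MotzkinFrom 0 P × length P ≡ m

-- twice the area under a path started at height h (trapezoid rule:
-- a step from height h to h' contributes (h + h')/2 to the area)
twiceAreaFrom : ℕ → List Step → ℕ
twiceAreaFrom h []           = 0
twiceAreaFrom h (up ∷ P)     = h + suc h + twiceAreaFrom (suc h) P
twiceAreaFrom h (flat _ ∷ P) = h + h + twiceAreaFrom h P
twiceAreaFrom h (down ∷ P)   = h + (h ∸ 1) + twiceAreaFrom (h ∸ 1) P

-- area of the region between P and the x-axis (twice the area is always
-- even for Motzkin paths, so the division is exact)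
area : List Step → ℕ
area P = twiceAreaFrom 0 P / 2

pattern1212 : List ℕ
pattern1212 = 1 ∷ 2 ∷ 1 ∷ 2 ∷ []

-- ψ reads a two-coloured Motzkin path as a noncrossing set partition written
-- letter by letter.  The state is the stack of open blocks, the current block
-- on top.  An up step opens a new block above the current one, a flat step
-- coloured a replaces the current block by a new one, a flat step coloured b
-- stays in the current block, and a down step closes the current block and
-- returns to the one below it; each step writes the letter of the block it
-- lands in.  Open blocks are properly nested, which is 1212-avoidance, and the
-- letters smaller than the current one that occur later are exactly the open
-- blocks below it, so rs of each letter is the height reached by the path
-- there.  Summing heights gives the area, since the path starts and ends at 0.
module Submission where

open import Defs
open import Data.Nat using (ℕ; suc; _≤_; _<_; _>_; _∸_; _+_; _*_; _⊔_; z≤n; s≤s; _<?_; _≟_; _≤?_)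
open import Data.Nat.Properties
open import Data.Nat.DivMod using (_/_; m*n/n≡m)
open import Data.Nat.Tactic.RingSolver using (solve-∀)
open import Data.List using (List; []; _∷_; length; filter; deduplicate)
open import Data.List.Properties using (∷-injectiveʳ)
open import Data.List.Membership.Propositional using (_∈_; _∉_)
open import Data.List.Membership.Propositional.Properties
  using (∈-filter⁺; ∈-filter⁻; ∈-deduplicate⁺; ∈-deduplicate⁻)
open import Data.List.Membership.Propositional.Properties.WithK using (unique∧set⇒bag)
open import Data.List.Membership.DecPropositional _≟_ using (_∈?_)
open import Data.List.Relation.Unary.Any using (here; there)
open import Data.List.Relation.Unary.All as All using (All; []; _∷_)
open import Data.List.Relation.Unary.AllPairs as AllPairs using (AllPairs; []; _∷_)
open import Data.List.Relation.Unary.Unique.Propositional using (Unique)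
import Data.List.Relation.Unary.Unique.Propositional.Properties as Unique
open import Data.List.Relation.Unary.Unique.DecPropositional.Properties _≟_ using (deduplicate-!)
open import Data.List.Relation.Binary.BagAndSetEquality using (∼bag⇒↭)
open import Data.List.Relation.Binary.Permutation.Propositional.Properties using (↭-length)
open import Data.List.Relation.Binary.Equality.Propositional using (≋⇒≡)
open import Data.List.Relation.Binary.Sublist.Propositional
  using (_⊆_; []; _∷_; _∷ʳ_; ⊆-refl; ⊆-trans; lookup; to∈; from∈)
open import Data.List.Relation.Binary.Sublist.Propositional.Properties
  using (filter⁺; length-mono-≤; to-≋)
open import Data.Product using (Σ; ∃; ∃₂; _×_; _,_; proj₂)
open import Data.Sum using (_⊎_; inj₁; inj₂)
open import Data.Empty using (⊥-elim)
open import Function.Bundles using (mk⇔)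
open import Relation.Nullary using (¬_; yes; no)
open import Relation.Binary.Definitions using (tri<; tri≈; tri>)
open import Relation.Binary.PropositionalEquality

record State : Set where
  constructor state
  field
    top     : ℕ
    below   : List ℕ
    largest : ℕ
open State

private
  variable
    t m r x y z : ℕ
    rest u w ys : List ℕ
    s : Step
    P Q : List Step
    σ : State

stack : State → List ℕ
stack σ = top σ ∷ below σ

-- A down step from an empty stack never occurs in a Motzkin path; it is made
-- to act like a flat step coloured b.
next : State → Step → State
next (state t rest m)       up       = state (suc m) (t ∷ rest) (suc m)
next (state t rest m)       (flat a) = state (suc m) rest (suc m)
next (state t rest m)       (flat b) = state t rest m
next (state t [] m)         down     = state t [] m
next (state t (r ∷ rest) m) down     = state r rest m

word : State → List Step → List ℕ
word σ []      = []
word σ (s ∷ P) = top (next σ s) ∷ word (next σ s) P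

start : State
start = state 1 [] 1

ψ : List Step → List ℕ
ψ P = top start ∷ word start P

record Valid (σ : State) : Set where
  constructor valid
  field
    decreasing  : AllPairs _>_ (stack σ)
    positive    : All (1 ≤_) (stack σ)
    top≤largest : top σ ≤ largest σ
open Valid

valid-start : Valid start
valid-start = valid ([] ∷ []) (s≤s z≤n ∷ []) ≤-refl

below<top : Valid σ → z ∈ below σ → z < top σ
below<top v = All.lookup (AllPairs.head (decreasing v))

stack≤top : Valid σ → z ∈ stack σ → z ≤ top σ
stack≤top v (here refl) = ≤-refl
stack≤top v (there k)   = <⇒≤ (below<top v k)

stack≤largest : Valid σ → z ∈ stack σ → z ≤ largest σ
stack≤largest v k = ≤-trans (stack≤top v k) (top≤largest v)

fresh≢stack : Valid σ → z ∈ stack σ → suc (largest σ) ≢ z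
fresh≢stack v k refl = 1+n≰n (stack≤largest v k)

below-unique : Valid σ → Unique (below σ)
below-unique v = AllPairs.map >⇒≢ (AllPairs.tail (decreasing v))

valid-next : ∀ s → Valid σ → Valid (next σ s)
valid-next {σ = state t rest m}       up       v =
  valid (stack<fresh ∷ decreasing v) (s≤s z≤n ∷ positive v) ≤-refl
  where
  stack<fresh : All (suc m >_) (t ∷ rest)
  stack<fresh = All.tabulate (λ k → s≤s (stack≤largest v k))
valid-next {σ = state t rest m}       (flat a) v =
  valid (stack<fresh ∷ AllPairs.tail (decreasing v)) (s≤s z≤n ∷ All.tail (positive v)) ≤-refl
  where
  stack<fresh : All (suc m >_) rest
  stack<fresh = All.tabulate (λ k → s≤s (stack≤largest v (there k)))
valid-next {σ = state t rest m}       (flat b) v = v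
valid-next {σ = state t [] m}         down     v = v
valid-next {σ = state t (r ∷ rest) m} down     v =
  valid (AllPairs.tail (decreasing v)) (All.tail (positive v)) (stack≤largest v (there (here refl)))

largest-mono : ∀ σ s → largest σ ≤ largest (next σ s)
largest-mono (state t rest m)       up       = n≤1+n m
largest-mono (state t rest m)       (flat a) = n≤1+n m
largest-mono (state t rest m)       (flat b) = ≤-refl
largest-mono (state t [] m)         down     = ≤-refl
largest-mono (state t (r ∷ rest) m) down     = ≤-refl

largest-next : ∀ s → Valid σ → largest σ ⊔ top (next σ s) ≡ largest (next σ s)
largest-next {σ = state t rest m}       up       v = m≤n⇒m⊔n≡n (n≤1+n m)
largest-next {σ = state t rest m}       (flat a) v = m≤n⇒m⊔n≡n (n≤1+n m)
largest-next {σ = state t rest m}       (flat b) v = m≥n⇒m⊔n≡m (top≤largest v)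
largest-next {σ = state t [] m}         down     v = m≥n⇒m⊔n≡m (top≤largest v)
largest-next {σ = state t (r ∷ rest) m} down     v = m≥n⇒m⊔n≡m (stack≤largest v (there (here refl)))

top-next≤ : ∀ s → Valid σ → top (next σ s) ≤ suc (largest σ)
top-next≤ {σ = state t rest m}       up       v = ≤-refl
top-next≤ {σ = state t rest m}       (flat a) v = ≤-refl
top-next≤ {σ = state t rest m}       (flat b) v = m≤n⇒m≤1+n (top≤largest v)
top-next≤ {σ = state t [] m}         down     v = m≤n⇒m≤1+n (top≤largest v)
top-next≤ {σ = state t (r ∷ rest) m} down     v = m≤n⇒m≤1+n (stack≤largest v (there (here refl)))

∈-stack-next : ∀ σ s → z ∈ stack (next σ s) → z ∈ stack σ ⊎ largest σ < z
∈-stack-next (state t rest m)       up       (here refl) = inj₂ ≤-refl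
∈-stack-next (state t rest m)       up       (there k)   = inj₁ k
∈-stack-next (state t rest m)       (flat a) (here refl) = inj₂ ≤-refl
∈-stack-next (state t rest m)       (flat a) (there k)   = inj₁ (there k)
∈-stack-next (state t rest m)       (flat b) k           = inj₁ k
∈-stack-next (state t [] m)         down     k           = inj₁ k
∈-stack-next (state t (r ∷ rest) m) down     k           = inj₁ (there k)

∈-below-next : ∀ σ s → z ∈ below σ → z ≡ top (next σ s) ⊎ z ∈ below (next σ s)
∈-below-next (state t rest m)       up       k           = inj₂ (there k)
∈-below-next (state t rest m)       (flat a) k           = inj₂ k
∈-below-next (state t rest m)       (flat b) k           = inj₂ k
∈-below-next (state t (r ∷ rest) m) down     (here refl) = inj₁ refl
∈-below-next (state t (r ∷ rest) m) down     (there k)   = inj₂ k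

motzkin-next : MotzkinFrom (length (below σ)) (s ∷ P) → MotzkinFrom (length (below (next σ s))) P
motzkin-next {σ = state t rest m}       {up}     (up mp)     = mp
motzkin-next {σ = state t rest m}       {flat a} (flat a mp) = mp
motzkin-next {σ = state t rest m}       {flat b} (flat b mp) = mp
motzkin-next {σ = state t [] m}         {down}   ()
motzkin-next {σ = state t (r ∷ rest) m} {down}   (down mp)   = mp

length-word : length (word σ P) ≡ length P
length-word {P = []}    = refl
length-word {σ = σ} {s ∷ P} = cong suc (length-word {σ = next σ s} {P})

∈-word⁻ : z ∈ word σ P → z ∈ stack σ ⊎ largest σ < z
∈-word⁻ {σ = σ} {s ∷ P} (here refl) = ∈-stack-next σ s (here refl)
∈-word⁻ {σ = σ} {s ∷ P} (there k) with ∈-word⁻ k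
... | inj₁ k′ = ∈-stack-next σ s k′
... | inj₂ lt = inj₂ (≤-<-trans (largest-mono σ s) lt)

∉-word : z ≤ largest σ → z ∉ stack σ → z ∉ word σ P
∉-word z≤ z∉ k with ∈-word⁻ k
... | inj₁ k′ = z∉ k′
... | inj₂ lt = <⇒≱ lt z≤

∈-word⁺ : MotzkinFrom (length (below σ)) P → z ∈ below σ → z ∈ word σ P
∈-word⁺ {σ = state t (r ∷ rest) m} {[]} () _
∈-word⁺ {σ = σ} {s ∷ P} mp k with ∈-below-next σ s k
... | inj₁ refl = here refl
... | inj₂ k′   = there (∈-word⁺ (motzkin-next mp) k′)

word-rgf : Valid σ → RGFFrom (largest σ) (word σ P)
word-rgf {P = []} _ = []
word-rgf {σ = σ} {s ∷ P} v =
  (All.head (positive (valid-next s v)) , top-next≤ s v)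
  ∷ subst (λ k → RGFFrom k (word (next σ s) P)) (sym (largest-next s v)) (word-rgf (valid-next s v))

no-old-letter-after-smaller : Valid σ → x < z → z ≤ largest σ → ¬ (x ∷ z ∷ []) ⊆ word σ P
no-old-letter-after-smaller {σ = σ} {P = s ∷ P} v x<z z≤ (_ ∷ʳ p) =
  no-old-letter-after-smaller (valid-next s v) x<z (≤-trans z≤ (largest-mono σ s)) p
no-old-letter-after-smaller {σ = σ} {P = s ∷ P} v x<z z≤ (refl ∷ p) with ∈-word⁻ (to∈ p)
... | inj₁ k  = <⇒≱ x<z (stack≤top (valid-next s v) k)
... | inj₂ lt = <⇒≱ lt (≤-trans z≤ (largest-mono σ s))

top∷word-¬yxy : Valid σ → x < y → ¬ (y ∷ x ∷ y ∷ []) ⊆ top σ ∷ word σ P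
top∷word-¬yxy {P = []}    v x<y (_ ∷ʳ ())
top∷word-¬yxy {P = []}    v x<y (_ ∷ ())
top∷word-¬yxy {P = s ∷ P} v x<y (_ ∷ʳ p)    = top∷word-¬yxy (valid-next s v) x<y p
top∷word-¬yxy {P = s ∷ P} v x<y (refl ∷ p) =
  no-old-letter-after-smaller v x<y (top≤largest v) p

lettersBelow : ℕ → List ℕ → List ℕ
lettersBelow x u = filter (_<? x) (deduplicate _≟_ u)

∈-lettersBelow⁺ : z ∈ u → z < x → z ∈ lettersBelow x u
∈-lettersBelow⁺ k z<x = ∈-filter⁺ (_<? _) (∈-deduplicate⁺ _≟_ k) z<x

∈-lettersBelow⁻ : ∀ u → z ∈ lettersBelow x u → z ∈ u × z < x
∈-lettersBelow⁻ u k with ∈-filter⁻ (_<? _) k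
... | k′ , z<x = ∈-deduplicate⁻ _≟_ u k′ , z<x

distinctBelow-≡-length : Unique ys → (∀ {z} → z ∈ u → z < x → z ∈ ys) →
                         (∀ {z} → z ∈ ys → z ∈ u × z < x) → distinctBelow x u ≡ length ys
distinctBelow-≡-length {u = u} unique-ys to from =
  ↭-length (∼bag⇒↭ (unique∧set⇒bag (Unique.filter⁺ (_<? _) (deduplicate-! u)) unique-ys
    (mk⇔ (λ k → let (k′ , z<x) = ∈-lettersBelow⁻ u k in to k′ z<x)
         (λ k → let (k′ , z<x) = from k in ∈-lettersBelow⁺ k′ z<x))))

distinctBelow-mono-< : x ∈ u → x < y → distinctBelow x u < distinctBelow y u
distinctBelow-mono-< {x} {u} {y} x∈u x<y =
  ≤∧≢⇒< (length-mono-≤ below-x⊆below-y) λ same-length →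
    let below-x≡below-y = ≋⇒≡ (to-≋ same-length below-x⊆below-y)
        x∈below-x = subst (x ∈_) (sym below-x≡below-y) (∈-lettersBelow⁺ x∈u x<y)
    in <-irrefl refl (proj₂ (∈-lettersBelow⁻ u x∈below-x))
  where
  below-x⊆below-y : lettersBelow x u ⊆ lettersBelow y u
  below-x⊆below-y = filter⁺ (_<? x) (_<? y) (λ { refl z<x → <-trans z<x x<y }) (⊆-refl {x = deduplicate _≟_ u})

distinctBelow-reflects-< : x ∈ u → y ∈ u → distinctBelow x u < distinctBelow y u → x < y
distinctBelow-reflects-< {x} {u} {y} x∈u y∈u lt with <-cmp x y
... | tri< x<y _ _ = x<y
... | tri≈ _ refl _ = ⊥-elim (<-irrefl refl lt)
... | tri> _ _ y<x = ⊥-elim (<-asym lt (distinctBelow-mono-< y∈u y<x))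

distinctBelow-injective : x ∈ u → y ∈ u → distinctBelow x u ≡ distinctBelow y u → x ≡ y
distinctBelow-injective {x} {u} {y} x∈u y∈u eq with <-cmp x y
... | tri< x<y _ _ = ⊥-elim (<-irrefl eq (distinctBelow-mono-< x∈u x<y))
... | tri≈ _ x≡y _ = x≡y
... | tri> _ _ y<x = ⊥-elim (<-irrefl (sym eq) (distinctBelow-mono-< y∈u y<x))

std-xyxy : x < y → std (x ∷ y ∷ x ∷ y ∷ []) ≡ pattern1212
std-xyxy {x} {y} x<y = counts none-below-x only-x-below-y
  where
  counts : ∀ {a b} → a ≡ 0 → b ≡ 1 → suc a ∷ suc b ∷ suc a ∷ suc b ∷ [] ≡ pattern1212
  counts refl refl = refl
  xyxy : List ℕ
  xyxy = x ∷ y ∷ x ∷ y ∷ []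
  ∈-xyxy : z ∈ xyxy → z ≡ x ⊎ z ≡ y
  ∈-xyxy (here refl)                         = inj₁ refl
  ∈-xyxy (there (here refl))                 = inj₂ refl
  ∈-xyxy (there (there (here refl)))         = inj₁ refl
  ∈-xyxy (there (there (there (here refl)))) = inj₂ refl
  none-below-x : distinctBelow x xyxy ≡ 0
  none-below-x = distinctBelow-≡-length [] to (λ ())
    where
    to : z ∈ xyxy → z < x → z ∈ []
    to k z<x with ∈-xyxy k
    ... | inj₁ refl = ⊥-elim (<-irrefl refl z<x)
    ... | inj₂ refl = ⊥-elim (<-asym x<y z<x)
  only-x-below-y : distinctBelow y xyxy ≡ 1
  only-x-below-y = distinctBelow-≡-length ([] ∷ []) to λ { (here refl) → here refl , x<y }
    where
    to : z ∈ xyxy → z < y → z ∈ x ∷ []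
    to k z<y with ∈-xyxy k
    ... | inj₁ refl = here refl
    ... | inj₂ refl = ⊥-elim (<-irrefl refl z<y)

std-1212 : std u ≡ pattern1212 → ∃₂ λ x y → x < y × u ≡ x ∷ y ∷ x ∷ y ∷ []
std-1212 {u = u@(p ∷ q ∷ r ∷ s ∷ [])} std≡ =
  let (cp , cq , cr , cs) = counts std≡
      p<q = distinctBelow-reflects-< {u = u} (here refl) (there (here refl)) (subst₂ _<_ (sym cp) (sym cq) (s≤s z≤n))
      p≡r = distinctBelow-injective {u = u} (here refl) (there (there (here refl))) (trans cp (sym cr))
      q≡s = distinctBelow-injective {u = u} (there (here refl)) (there (there (there (here refl)))) (trans cq (sym cs))
  in p , q , p<q , cong₂ (λ x y → p ∷ q ∷ x ∷ y ∷ []) (sym p≡r) (sym q≡s)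
  where
  counts : ∀ {a b c d} → suc a ∷ suc b ∷ suc c ∷ suc d ∷ [] ≡ pattern1212 →
           a ≡ 0 × b ≡ 1 × c ≡ 0 × d ≡ 1
  counts refl = refl , refl , refl , refl

motzkin-[] : MotzkinFrom z [] → z ≡ 0
motzkin-[] [] = refl

twiceAreaFrom-next : ∀ σ s → twiceAreaFrom (length (below σ)) (s ∷ P) ≡
  length (below σ) + length (below (next σ s)) + twiceAreaFrom (length (below (next σ s))) P
twiceAreaFrom-next (state t rest m)       up       = refl
twiceAreaFrom-next (state t rest m)       (flat a) = refl
twiceAreaFrom-next (state t rest m)       (flat b) = refl
twiceAreaFrom-next (state t [] m)         down     = refl
twiceAreaFrom-next (state t (r ∷ rest) m) down     = refl

distinctBelow-word : Valid σ → MotzkinFrom (length (below σ)) P →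
                     distinctBelow (top σ) (word σ P) ≡ length (below σ)
distinctBelow-word {σ} {P} v mp =
  distinctBelow-≡-length (below-unique v) later-below (λ k → ∈-word⁺ mp k , below<top v k)
  where
  later-below : z ∈ word σ P → z < top σ → z ∈ below σ
  later-below k z<t with ∈-word⁻ k
  ... | inj₁ (here refl) = ⊥-elim (<-irrefl refl z<t)
  ... | inj₁ (there k′)  = k′
  ... | inj₂ lt          = ⊥-elim (<-irrefl refl (<-≤-trans (<-trans lt z<t) (top≤largest v)))

rs-word : Valid σ → MotzkinFrom (length (below σ)) P →
          rs (word σ P) * 2 + length (below σ) ≡ twiceAreaFrom (length (below σ)) P
rs-word {P = []} _ mp = motzkin-[] mp
rs-word {σ} {s ∷ P} v mp =
  begin
    (distinctBelow (top σ′) (word σ′ P) + rs (word σ′ P)) * 2 + h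
  ≡⟨ cong (λ d → (d + rs (word σ′ P)) * 2 + h) (distinctBelow-word v′ mp′) ⟩
    (h′ + rs (word σ′ P)) * 2 + h
  ≡⟨ regroup h h′ (rs (word σ′ P)) ⟩
    h + h′ + (rs (word σ′ P) * 2 + h′)
  ≡⟨ cong (h + h′ +_) (rs-word v′ mp′) ⟩
    h + h′ + twiceAreaFrom h′ P
  ≡⟨ twiceAreaFrom-next σ s ⟨
    twiceAreaFrom h (s ∷ P)
  ∎
  where
  open ≡-Reasoning
  σ′ : State
  σ′ = next σ s
  h h′ : ℕ
  h  = length (below σ)
  h′ = length (below σ′)
  v′ : Valid σ′
  v′ = valid-next s v
  mp′ : MotzkinFrom h′ P
  mp′ = motzkin-next mp
  regroup : ∀ h h′ r → (h′ + r) * 2 + h ≡ h + h′ + (r * 2 + h′)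
  regroup = solve-∀

area≡rs∘ψ : MotzkinFrom 0 P → area P ≡ rs (ψ P)
area≡rs∘ψ {P} mp =
  begin
    twiceAreaFrom 0 P / 2
  ≡⟨ cong (_/ 2) (rs-word valid-start mp) ⟨
    (rs (word start P) * 2 + 0) / 2
  ≡⟨ cong (_/ 2) (+-identityʳ (rs (word start P) * 2)) ⟩
    rs (word start P) * 2 / 2
  ≡⟨ m*n/n≡m _ 2 ⟩
    rs (word start P)
  ≡⟨ cong (_+ rs (word start P)) (distinctBelow-word valid-start mp) ⟨
    distinctBelow 1 (word start P) + rs (word start P)
  ∎
  where open ≡-Reasoning

-- A fresh letter comes from an up step exactly when the current block is
-- still open, i.e. when its letter occurs again later.
decodeStep : State → ℕ → List ℕ → Step
decodeStep (state t rest m) x w with x ≟ suc m | t ∈? w | x ≟ t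
... | yes _ | yes _ | _     = up
... | yes _ | no _  | _     = flat a
... | no _  | _     | yes _ = flat b
... | no _  | _     | no _  = down

decode : State → List ℕ → List Step
decode σ []      = []
decode σ (x ∷ w) = decodeStep σ x w ∷ decode (next σ (decodeStep σ x w)) w

decodeStep-next : Valid σ → MotzkinFrom (length (below σ)) (s ∷ P) →
                  decodeStep σ (top (next σ s)) (word (next σ s) P) ≡ s
decodeStep-next {σ = state t rest m} {up} {P} _ (up mp)
  with suc m ≟ suc m | t ∈? word (next (state t rest m) up) P
... | yes _ | yes _ = refl
... | yes _ | no t∉ = ⊥-elim (t∉ (∈-word⁺ mp (here refl)))
... | no ≢  | _     = ⊥-elim (≢ refl)
decodeStep-next {σ = state t rest m} {flat a} {P} v (flat a _)
  with suc m ≟ suc m | t ∈? word (next (state t rest m) (flat a)) P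
... | yes _ | no _   = refl
... | no ≢  | _      = ⊥-elim (≢ refl)
... | yes _ | yes t∈ =
  ⊥-elim (∉-word {σ = state (suc m) rest (suc m)} (m≤n⇒m≤1+n (top≤largest v)) t∉stack t∈)
  where
  t∉stack : t ∉ suc m ∷ rest
  t∉stack (here t≡) = fresh≢stack v (here refl) (sym t≡)
  t∉stack (there k) = <-irrefl refl (below<top v k)
decodeStep-next {σ = state t rest m} {flat b} v (flat b _) with t ≟ suc m | t ≟ t
... | yes t≡ | _     = ⊥-elim (fresh≢stack v (here refl) (sym t≡))
... | no _   | yes _ = refl
... | no _   | no ≢  = ⊥-elim (≢ refl)
decodeStep-next {σ = state t (r ∷ rest) m} {down} v (down _) with r ≟ suc m | r ≟ t
... | yes r≡ | _      = ⊥-elim (fresh≢stack v (there (here refl)) (sym r≡))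
... | no _   | yes r≡ = ⊥-elim (<-irrefl r≡ (below<top v (here refl)))
... | no _   | no _   = refl

decode-word : Valid σ → MotzkinFrom (length (below σ)) P → decode σ (word σ P) ≡ P
decode-word {P = []} _ _ = refl
decode-word {P = s ∷ P} v mp rewrite decodeStep-next v mp =
  cong (s ∷_) (decode-word (valid-next s v) (motzkin-next mp))

record Continuation (σ : State) (w : List ℕ) : Set where
  field
    rgf         : RGFFrom (largest σ) w
    reopened    : z ∈ below σ → z ∈ w
    only-open   : z ∈ w → z ≤ largest σ → z ∈ stack σ
    ¬yxy        : x < y → ¬ (y ∷ x ∷ y ∷ []) ⊆ w
    ¬below-open : z ∈ stack σ → x < z → ¬ (x ∷ z ∷ []) ⊆ w
open Continuation

Legal : State → Step → Set
Legal σ s = ∀ {P} → MotzkinFrom (length (below (next σ s))) P → MotzkinFrom (length (below σ)) (s ∷ P)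

StepWriting : State → ℕ → List ℕ → Set
StepWriting σ x w = ∃ λ s → top (next σ s) ≡ x × Continuation (next σ s) w × Legal σ s

∈-tail : z ∈ x ∷ w → z ≢ x → z ∈ w
∈-tail (here z≡x) z≢x = ⊥-elim (z≢x z≡x)
∈-tail (there k)  _   = k

rgf-head : RGFFrom m (x ∷ w) → 1 ≤ x × x ≤ suc m
rgf-head (bounds ∷ _) = bounds

rgf-next : ∀ s → Valid σ → RGFFrom (largest σ) (top (next σ s) ∷ w) → RGFFrom (largest (next σ s)) w
rgf-next s v (_ ∷ r) = subst (λ k → RGFFrom k _) (largest-next s v) r

¬yxy-∷ : Continuation σ (x ∷ w) → y < z → ¬ (z ∷ y ∷ z ∷ []) ⊆ w
¬yxy-∷ c lt p = ¬yxy c lt (_ ∷ʳ p)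

¬below-open-∷ : Continuation σ (x ∷ w) → z ∈ stack σ → y < z → ¬ (y ∷ z ∷ []) ⊆ w
¬below-open-∷ c k lt p = ¬below-open c k lt (_ ∷ʳ p)

module _ (v : Valid (state t rest m)) (c : Continuation (state t rest m) (suc m ∷ w)) where
  private
    rest-reopened : z ∈ rest → z ∈ w
    rest-reopened k = ∈-tail (reopened c k) (λ z≡ → fresh≢stack v (there k) (sym z≡))

    fresh-or-open : z ∈ w → z ≤ suc m → z ≡ suc m ⊎ z ∈ t ∷ rest
    fresh-or-open {z} k z≤ with z ≟ suc m
    ... | yes z≡ = inj₁ z≡
    ... | no z≢  = inj₂ (only-open c (there k) (≤-pred (≤∧≢⇒< z≤ z≢)))

    fresh-¬below : y < suc m → ¬ (y ∷ suc m ∷ []) ⊆ w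
    fresh-¬below lt p = ¬yxy c lt (refl ∷ p)

  open-above : t ∈ w → Continuation (state (suc m) (t ∷ rest) (suc m)) w
  open-above t∈w = record
    { rgf         = rgf-next up v (rgf c)
    ; reopened    = λ { (here refl) → t∈w ; (there k) → rest-reopened k }
    ; only-open   = λ k z≤ → case-fresh (fresh-or-open k z≤)
    ; ¬yxy        = ¬yxy-∷ c
    ; ¬below-open = λ { (here refl) → fresh-¬below ; (there k) → ¬below-open-∷ c k }
    }
    where
    case-fresh : z ≡ suc m ⊎ z ∈ t ∷ rest → z ∈ suc m ∷ t ∷ rest
    case-fresh (inj₁ refl) = here refl
    case-fresh (inj₂ k)    = there k

  replace-top : t ∉ w → Continuation (state (suc m) rest (suc m)) w
  replace-top t∉w = record
    { rgf         = rgf-next (flat a) v (rgf c)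
    ; reopened    = rest-reopened
    ; only-open   = λ k z≤ → case-fresh k (fresh-or-open k z≤)
    ; ¬yxy        = ¬yxy-∷ c
    ; ¬below-open = λ { (here refl) → fresh-¬below ; (there k) → ¬below-open-∷ c (there k) }
    }
    where
    case-fresh : z ∈ w → z ≡ suc m ⊎ z ∈ t ∷ rest → z ∈ suc m ∷ rest
    case-fresh _ (inj₁ refl)        = here refl
    case-fresh k (inj₂ (here refl)) = ⊥-elim (t∉w k)
    case-fresh _ (inj₂ (there k′))  = there k′

fresh-step : Valid (state t rest m) → Continuation (state t rest m) (suc m ∷ w) →
             StepWriting (state t rest m) (suc m) w
fresh-step {t} {w = w} v c with t ∈? w
... | yes t∈w = up , refl , open-above v c t∈w , up
... | no t∉w  = flat a , refl , replace-top v c t∉w , flat a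

stay-step : Valid (state t rest m) → Continuation (state t rest m) (t ∷ w) →
            StepWriting (state t rest m) t w
stay-step {t = t} {rest = rest} {m = m} {w = w} v c = flat b , refl , continuation , flat b
  where
  continuation : Continuation (state t rest m) w
  continuation = record
    { rgf         = rgf-next (flat b) v (rgf c)
    ; reopened    = λ k → ∈-tail (reopened c k) (λ { refl → <-irrefl refl (below<top v k) })
    ; only-open   = λ k z≤ → only-open c (there k) z≤
    ; ¬yxy        = ¬yxy-∷ c
    ; ¬below-open = ¬below-open-∷ c
    }

pop-step : Valid (state t rest m) → Continuation (state t rest m) (x ∷ w) → x ∈ rest →
           StepWriting (state t rest m) x w
pop-step {t} {r ∷ rest} {m} {x} {w} v c (here refl) = down , refl , continuation , down
  where
  v′ : Valid (state r rest m)
  v′ = valid-next down v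
  only-open′ : z ∈ w → z ≤ m → z ∈ r ∷ rest
  only-open′ k z≤ with only-open c (there k) z≤
  ... | here refl = ⊥-elim (¬below-open c (here refl) (below<top v (here refl)) (refl ∷ from∈ k))
  ... | there k′  = k′
  continuation : Continuation (state r rest m) w
  continuation = record
    { rgf         = rgf-next down v (rgf c)
    ; reopened    = λ k → ∈-tail (reopened c (there k)) (λ { refl → <-irrefl refl (below<top v′ k) })
    ; only-open   = only-open′
    ; ¬yxy        = ¬yxy-∷ c
    ; ¬below-open = λ k → ¬below-open-∷ c (there k)
    }
pop-step {t} {r ∷ rest} {m} {x} {w} v c (there k) =
  ⊥-elim (¬below-open c (there (here refl)) x<r (refl ∷ from∈ r∈w))
  where
  x<r : x < r
  x<r = below<top (valid-next down v) k
  r∈w : r ∈ w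
  r∈w = ∈-tail (reopened c (here refl)) (λ { refl → <-irrefl refl x<r })

continuation-step : Valid σ → Continuation σ (x ∷ w) → StepWriting σ x w
continuation-step {σ = state t rest m} {x} v c with x ≟ suc m
... | yes refl = fresh-step v c
... | no x≢ with only-open c (here refl) (≤-pred (≤∧≢⇒< (proj₂ (rgf-head (rgf c))) x≢))
...   | here refl = stay-step v c
...   | there k   = pop-step v c k

word-surjective : Valid σ → Continuation σ w → ∃ λ P → MotzkinFrom (length (below σ)) P × word σ P ≡ w
word-surjective {σ = state t [] m}      {[]} _ _ = [] , [] , refl
word-surjective {σ = state t (r ∷ _) m} {[]} _ c with reopened c (here refl)
... | ()
word-surjective {w = x ∷ w} v c with continuation-step v c
... | s , refl , c′ , legal with word-surjective (valid-next s v) c′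
...   | P , mp , refl = s ∷ P , legal mp , refl

rgf-positive : RGFFrom m w → z ∈ w → 1 ≤ z
rgf-positive ((1≤z , _) ∷ _) (here refl) = 1≤z
rgf-positive (_ ∷ r)         (there k)   = rgf-positive r k

rgf-earlier : RGFFrom m w → (y ∷ u) ⊆ w → x < y → x ≤ m ⊎ (x ∷ y ∷ u) ⊆ w
rgf-earlier ((_ , y≤) ∷ _) (refl ∷ _) x<y = inj₁ (≤-pred (≤-trans x<y y≤))
rgf-earlier {m} {c ∷ w} {x = x} ((_ , c≤) ∷ r) (_ ∷ʳ p) x<y with rgf-earlier r p x<y
... | inj₂ q = inj₂ (c ∷ʳ q)
... | inj₁ x≤m⊔c with ⊔-sel m c
...   | inj₁ m⊔c≡m = inj₁ (subst (x ≤_) m⊔c≡m x≤m⊔c)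
...   | inj₂ m⊔c≡c with x ≤? m
...     | yes x≤m = inj₁ x≤m
...     | no x≰m  = inj₂ (subst (λ d → (d ∷ _) ⊆ (c ∷ w)) (sym x≡c) (refl ∷ p))
  where x≡c = ≤-antisym (subst (x ≤_) m⊔c≡c x≤m⊔c) (≤-trans c≤ (≰⇒> x≰m))

continuation-start : RGFFrom 1 w → Avoids (1 ∷ w) pattern1212 → Continuation start w
continuation-start {w} r av = record
  { rgf         = r
  ; reopened    = λ ()
  ; only-open   = λ k z≤1 → here (≤-antisym z≤1 (rgf-positive r k))
  ; ¬yxy        = ¬yxy′
  ; ¬below-open = λ { (here refl) x<1 p → <⇒≱ x<1 (rgf-positive r (lookup p (here refl))) }
  }
  where
  ¬yxy′ : x < y → ¬ (y ∷ x ∷ y ∷ []) ⊆ w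
  ¬yxy′ x<y p with rgf-earlier ((≤-refl , ≤-refl) ∷ r) (1 ∷ʳ p) x<y
  ... | inj₁ x≤0 = <⇒≱ (rgf-positive r (lookup p (there (here refl)))) x≤0
  ... | inj₂ q   = av (_ , q , std-xyxy x<y)

ψ-length : ∀ P → length (ψ P) ≡ suc (length P)
ψ-length P = cong suc (length-word {start} {P})

ψ-rgf : IsRGF (ψ P)
ψ-rgf = refl , word-rgf valid-start

ψ-avoids : Avoids (ψ P) pattern1212
ψ-avoids (u , u⊆ψP , std-u) with std-1212 std-u
... | x , y , x<y , refl = top∷word-¬yxy valid-start x<y (⊆-trans (x ∷ʳ ⊆-refl) u⊆ψP)

ψ-injective : MotzkinFrom 0 P → MotzkinFrom 0 Q → ψ P ≡ ψ Q → P ≡ Q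
ψ-injective {P} {Q} mp mq eq =
  begin
    P                           ≡⟨ decode-word valid-start mp ⟨
    decode start (word start P) ≡⟨ cong (decode start) (∷-injectiveʳ eq) ⟩
    decode start (word start Q) ≡⟨ decode-word valid-start mq ⟩
    Q
  ∎
  where open ≡-Reasoning

ψ-surjective : IsRGF (x ∷ w) → Avoids (x ∷ w) pattern1212 → ∃ λ P → MotzkinFrom 0 P × ψ P ≡ x ∷ w
ψ-surjective (refl , r) av with word-surjective valid-start (continuation-start r av)
... | P , mp , refl = P , mp , refl

theorem5p7 : (n : ℕ) → 1 ≤ n →
    Σ (List Step → List ℕ) λ ψ →
      ((P : List Step) → IsMotzkin2 (n ∸ 1) P → InR n pattern1212 (ψ P))
      × ((P Q : List Step) → IsMotzkin2 (n ∸ 1) P → IsMotzkin2 (n ∸ 1) Q →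
           ψ P ≡ ψ Q → P ≡ Q)
      × ((w : List ℕ) → InR n pattern1212 w →
           ∃ λ P → IsMotzkin2 (n ∸ 1) P × ψ P ≡ w)
      × ((P : List Step) → IsMotzkin2 (n ∸ 1) P → area P ≡ rs (ψ P))
theorem5p7 n 1≤n = ψ , sound , (λ P Q (mp , _) (mq , _) → ψ-injective mp mq) , complete ,
                   λ P (mp , _) → area≡rs∘ψ mp
  where
  sound : (P : List Step) → IsMotzkin2 (n ∸ 1) P → InR n pattern1212 (ψ P)
  sound P (_ , len) = ψ-rgf , trans (ψ-length P) (trans (cong suc len) (m+[n∸m]≡n 1≤n)) , ψ-avoids
  complete : (w : List ℕ) → InR n pattern1212 w → ∃ λ P → IsMotzkin2 (n ∸ 1) P × ψ P ≡ w
  complete []      (_ , len , _) = ⊥-elim (1+n≰n (subst (1 ≤_) (sym len) 1≤n))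
  complete (x ∷ w) (rgf , len , av) with ψ-surjective rgf av
  ... | P , mp , refl = P , (mp , cong (_∸ 1) (trans (sym (ψ-length P)) len)) , refl
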